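{- For every integer $n \ge 2$, the dimension of the polytope $\Omega_n$ is $\dim \Omega_n = \frac{n(n+1)}{2}$.
   Context: Fix an integer $n \ge 2$. Consider the rational affine space $\mathbb{Q}^{4n^2}$ whose coordinates are indexed as $X_{ijpq}$ with $i,j \in \{1,\dots,n\}$ and $p,q \in \{1,2\}$. For each function $\rho:\{1,\dots,n\}\to\{1,2\}$ define the point $X^{\rho}$ by $X^{\rho}_{ijpq}=1$ if $p=\rho(i)$ and $q=\rho(j)$, and $X^{\rho}_{ijpq}=0$ otherwise. The polytope $\Omega_n \subset \mathbb{Q}^{4n^2}$ is the convex hull of all the points $X^{\rho}$. The dimension of a polytope is the dimension of its affine hull. -}

module Defs where

open import Data.Nat using (ℕ; zero; suc)
open import Data.Fin using (Fin; zero; suc)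
open import Data.Product using (Σ; ∃; _×_; _,_)
open import Data.Rational using (ℚ; 0ℚ; 1ℚ; _+_; _*_; _≤_)
open import Relation.Binary.PropositionalEquality using (_≡_)
open import Relation.Nullary using (¬_)

sumFin : (k : ℕ) → (Fin k → ℚ) → ℚ
sumFin zero    f = 0ℚ
sumFin (suc k) f = f zero + sumFin k (λ t → f (suc t))

Point : ℕ → Set
Point n = Fin n → Fin n → Fin 2 → Fin 2 → ℚ

δ : Fin 2 → Fin 2 → ℚ
δ zero       zero       = 1ℚ
δ (suc zero) (suc zero) = 1ℚ
δ _          _          = 0ℚ

X : {n : ℕ} → (Fin n → Fin 2) → Point n
X ρ i j p q = δ p (ρ i) * δ q (ρ j)

Ω : (n : ℕ) → Point n → Set
Ω n x = Σ ℕ λ k → Σ (Fin k → (Fin n → Fin 2)) λ ρs → Σ (Fin k → ℚ) λ μ →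
          (∀ t → 0ℚ ≤ μ t) × (sumFin k μ ≡ 1ℚ) ×
          (∀ i j p q → x i j p q ≡ sumFin k (λ t → μ t * X (ρs t) i j p q))

AffinelyIndependent : {n m : ℕ} → (Fin m → Point n) → Set
AffinelyIndependent {n} {m} ps =
  (μ : Fin m → ℚ) → sumFin m μ ≡ 0ℚ →
  (∀ i j p q → sumFin m (λ t → μ t * ps t i j p q) ≡ 0ℚ) →
  ∀ t → μ t ≡ 0ℚ

HasDimension : {n : ℕ} → (Point n → Set) → ℕ → Set
HasDimension {n} S d =
  (Σ (Fin (suc d) → Point n) λ ps → (∀ t → S (ps t)) × AffinelyIndependent ps)
  × ((ps : Fin (suc (suc d)) → Point n) → (∀ t → S (ps t)) → ¬ AffinelyIndependent ps)

-- Write w_ij = X_ij11.  At a vertex X^ρ one has w_ij = w_ji, and by inclusion–exclusion every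
-- X_ijpq is a fixed affine expression in w_ii, w_jj and w_ij; both relations survive convex
-- combinations.  So Ω_n lies in an affine space parametrised by the n(n+1)/2 numbers w_ij with
-- i ≤ j, and any n(n+1)/2 + 2 of its points are affinely dependent, by Gaussian elimination on
-- the vectors (1, (w_ij)_{i≤j}).  Conversely take the vertex ρ ≡ 2 and, for each i ≤ j, the
-- vertex with ρ⁻¹(1) = {i, j}.  At the vertex with ρ⁻¹(1) = S, w_ij is 1 if {i, j} ⊆ S and 0
-- otherwise.  So in an affine relation among these vertices the coordinate w_ij with i < j
-- isolates the vertex {i, j}; once those weights vanish, w_ii isolates the vertex {i}, and the
-- weights summing to zero kill the vertex ρ ≡ 2.

module Submission where

open import Defs
open import Data.Nat as ℕ using (ℕ; zero; suc)
open import Data.Fin using (Fin; zero; suc; punchIn)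
open import Data.Product using (∃-syntax; _×_; _,_; proj₁; proj₂; map)
open import Data.Sum using (_⊎_; inj₁; inj₂)
open import Data.Vec.Functional using (Vector; _∷_; tail)
open import Function using (_∘_)
open import Relation.Binary.PropositionalEquality
open import Relation.Nullary using (¬_; yes; no; contradiction)

module Triangular where

  open import Data.Nat using (_+_; _*_)
  open import Data.Nat.DivMod using (_/_; m*n/n≡m)
  open import Data.Nat.Properties using (*-distribʳ-+; <⇒≱)
  open import Data.Nat.Solver using (module +-*-Solver)
  open import Data.Fin using (_≤_; inject₁; fromℕ; splitAt; _↑ˡ_; _↑ʳ_)
  open import Data.Fin.Properties
    using (+↔⊎; ≤fromℕ; toℕ<n; toℕ-fromℕ; toℕ-inject₁; inject₁-injective; fromℕ≢inject₁;
           splitAt-↑ˡ; splitAt-↑ʳ)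
  open import Data.Fin.Relation.Unary.Top using (view; ‵fromℕ; ‵inject₁)
  open import Function.Bundles using (Injection)
  open import Function.Properties.Inverse using (↔⇒↣)
  open ≡-Reasoning

  triangle : ℕ → ℕ
  triangle zero    = 0
  triangle (suc n) = triangle n + suc n

  triangle≡n*[1+n]/2 : ∀ n → triangle n ≡ n * suc n / 2
  triangle≡n*[1+n]/2 n = begin
    triangle n         ≡⟨ m*n/n≡m (triangle n) 2 ⟨
    triangle n * 2 / 2 ≡⟨ cong (_/ 2) (triangle*2 n) ⟩
    n * suc n / 2      ∎
    where
    open +-*-Solver
    triangle*2 : ∀ n → triangle n * 2 ≡ n * suc n
    triangle*2 zero    = refl
    triangle*2 (suc n) = begin
      (triangle n + suc n) * 2   ≡⟨ *-distribʳ-+ 2 (triangle n) (suc n) ⟩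
      triangle n * 2 + suc n * 2 ≡⟨ cong (_+ suc n * 2) (triangle*2 n) ⟩
      n * suc n + suc n * 2      ≡⟨ solve 1 (λ n → n :* (con 1 :+ n) :+ (con 1 :+ n) :* con 2
                                                 := (con 1 :+ n) :* (con 2 :+ n)) refl n ⟩
      suc n * suc (suc n)        ∎

  pair : ∀ n → Fin (triangle n) → Fin n × Fin n
  pairOfSplit : ∀ {n} → Fin (triangle n) ⊎ Fin (suc n) → Fin (suc n) × Fin (suc n)

  pair (suc n) = pairOfSplit ∘ splitAt (triangle n)

  pairOfSplit (inj₁ s) = map inject₁ inject₁ (pair _ s)
  pairOfSplit (inj₂ i) = i , fromℕ _

  pair-ordered : ∀ n (s : Fin (triangle n)) → proj₁ (pair n s) ≤ proj₂ (pair n s)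
  pair-ordered (suc n) s = pairOfSplit-ordered (splitAt (triangle n) s)
    where
    pairOfSplit-ordered : ∀ x → proj₁ (pairOfSplit x) ≤ proj₂ (pairOfSplit x)
    pairOfSplit-ordered (inj₁ s′) = subst₂ ℕ._≤_ (sym (toℕ-inject₁ (proj₁ (pair n s′))))
                                                 (sym (toℕ-inject₁ (proj₂ (pair n s′))))
                                                 (pair-ordered n s′)
    pairOfSplit-ordered (inj₂ i)  = ≤fromℕ i

  pair-injective : ∀ {n} {s s′ : Fin (triangle n)} → pair n s ≡ pair n s′ → s ≡ s′
  pair-injective {suc n} {s} {s′} eq =
    Injection.injective (↔⇒↣ (+↔⊎ {triangle n})) (pairOfSplit-injective (splitAt _ s) (splitAt _ s′) eq)
    where
    pairOfSplit-injective : ∀ x y → pairOfSplit x ≡ pairOfSplit y → x ≡ y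
    pairOfSplit-injective (inj₁ a) (inj₁ b) e = cong inj₁ (pair-injective
      (cong₂ _,_ (inject₁-injective (cong proj₁ e)) (inject₁-injective (cong proj₂ e))))
    pairOfSplit-injective (inj₁ a) (inj₂ j) e = contradiction (sym (cong proj₂ e)) fromℕ≢inject₁
    pairOfSplit-injective (inj₂ i) (inj₁ b) e = contradiction (cong proj₂ e) fromℕ≢inject₁
    pairOfSplit-injective (inj₂ i) (inj₂ j) e = cong inj₂ (cong proj₁ e)

  pair-surjective : ∀ {n} {i j : Fin n} → i ≤ j → ∃[ s ] pair n s ≡ (i , j)
  pair-surjective {suc n} {i} {j} i≤j with view j
  ... | ‵fromℕ = triangle n ↑ʳ i , cong pairOfSplit (splitAt-↑ʳ (triangle n) (suc n) i)
  ... | ‵inject₁ j′ with view i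
  ...   | ‵fromℕ = contradiction (subst₂ ℕ._≤_ (toℕ-fromℕ n) (toℕ-inject₁ j′) i≤j) (<⇒≱ (toℕ<n j′))
  ...   | ‵inject₁ i′ with pair-surjective (subst₂ ℕ._≤_ (toℕ-inject₁ i′) (toℕ-inject₁ j′) i≤j)
  ...     | s , pair-s≡i′j′ = s ↑ˡ suc n , (begin
    pairOfSplit (splitAt (triangle n) (s ↑ˡ suc n)) ≡⟨ cong pairOfSplit (splitAt-↑ˡ (triangle n) s (suc n)) ⟩
    map inject₁ inject₁ (pair n s)                  ≡⟨ cong (map inject₁ inject₁) pair-s≡i′j′ ⟩
    (inject₁ i′ , inject₁ j′)                        ∎)

open Triangular

module LinearAlgebra where

  open import Algebra.Bundles using (Ring)
  open import Data.Nat.Properties using (m<n⇒m<1+n)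
  open import Data.Fin.Properties using (all?; ¬∀⟶∃¬; punchInᵢ≢i)
  open import Data.Rational using (ℚ; 0ℚ; 1ℚ; _+_; _*_; -_; _-_; 1/_; NonZero; ≢-nonZero)
  open import Data.Rational.Properties
    using (+-*-ring; _≟_; +-comm; +-identityʳ; +-inverseʳ; *-assoc; *-identityʳ; *-zeroʳ; *-inverseˡ;
           *-distribˡ-+; neg-distrib-+; neg-distribˡ-*; neg-distribʳ-*)
  open import Algebra.Properties.Semiring.Sum (Ring.semiring +-*-ring)
    using (sum; sum-cong-≗; sum-replicate-zero; sum-remove; ∑-distrib-+; *-distribʳ-sum)
  open import Data.Vec.Functional using (insertAt; removeAt)
  open import Data.Vec.Functional.Properties using (insertAt-lookup; insertAt-punchIn)
  open ≡-Reasoning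

  sumFin≡sum : ∀ k (f : Vector ℚ k) → sumFin k f ≡ sum f
  sumFin≡sum zero    f = refl
  sumFin≡sum (suc k) f = cong (f zero +_) (sumFin≡sum k (tail f))

  sum-zero : ∀ {k} {f : Vector ℚ k} → (∀ t → f t ≡ 0ℚ) → sum f ≡ 0ℚ
  sum-zero {k} f≗0 = trans (sum-cong-≗ f≗0) (sum-replicate-zero k)

  sum-single : ∀ {k} (f : Vector ℚ (suc k)) t₀ → (∀ t → t ≢ t₀ → f t ≡ 0ℚ) → sum f ≡ f t₀
  sum-single f t₀ others = begin
    sum f                      ≡⟨ sum-remove {i = t₀} f ⟩
    f t₀ + sum (removeAt f t₀) ≡⟨ cong (f t₀ +_) (sum-zero λ t → others _ (punchInᵢ≢i t₀ t)) ⟩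
    f t₀ + 0ℚ                  ≡⟨ +-identityʳ (f t₀) ⟩
    f t₀                       ∎

  infix 8 _·_

  _·_ : ∀ {k} → Vector ℚ k → Vector ℚ k → ℚ
  μ · f = sum λ t → μ t * f t

  ·-cong : ∀ {k} (μ : Vector ℚ k) {f g : Vector ℚ k} → (∀ t → f t ≡ g t) → μ · f ≡ μ · g
  ·-cong μ f≗g = sum-cong-≗ λ t → cong (μ t *_) (f≗g t)

  ·-zeroʳ : ∀ {k} (μ : Vector ℚ k) {f : Vector ℚ k} → (∀ t → f t ≡ 0ℚ) → μ · f ≡ 0ℚ
  ·-zeroʳ μ f≗0 = sum-zero λ t → trans (cong (μ t *_) (f≗0 t)) (*-zeroʳ (μ t))

  ·-identityʳ : ∀ {k} (μ : Vector ℚ k) → μ · (λ _ → 1ℚ) ≡ sum μ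
  ·-identityʳ μ = sum-cong-≗ λ t → *-identityʳ (μ t)

  ·-distrib-+ : ∀ {k} (μ f g : Vector ℚ k) → μ · (λ t → f t + g t) ≡ μ · f + μ · g
  ·-distrib-+ μ f g = trans (sum-cong-≗ λ t → *-distribˡ-+ (μ t) (f t) (g t))
                            (∑-distrib-+ (λ t → μ t * f t) (λ t → μ t * g t))

  ·-neg : ∀ {k} (μ f : Vector ℚ k) → μ · (λ t → - f t) ≡ - (μ · f)
  ·-neg {zero}  μ f = refl
  ·-neg {suc k} μ f = trans (cong₂ _+_ (sym (neg-distribʳ-* (μ zero) (f zero))) (·-neg (tail μ) (tail f)))
                            (sym (neg-distrib-+ (μ zero * f zero) (tail μ · tail f)))

  ·-distrib-- : ∀ {k} (μ f g : Vector ℚ k) → μ · (λ t → f t - g t) ≡ μ · f - μ · g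
  ·-distrib-- μ f g = trans (·-distrib-+ μ f (λ t → - g t)) (cong (μ · f +_) (·-neg μ g))

  ·-*ʳ : ∀ {k} (μ f : Vector ℚ k) a → μ · (λ t → f t * a) ≡ μ · f * a
  ·-*ʳ μ f a = trans (sum-cong-≗ λ t → sym (*-assoc (μ t) (f t) a))
                     (sym (*-distribʳ-sum a (λ t → μ t * f t)))

  ·-insertAt : ∀ {k} (ν : Vector ℚ k) t₀ a (f : Vector ℚ (suc k)) →
               insertAt ν t₀ a · f ≡ a * f t₀ + ν · (f ∘ punchIn t₀)
  ·-insertAt ν t₀ a f = trans (sum-remove {i = t₀} (λ t → insertAt ν t₀ a t * f t))
    (cong₂ _+_ (cong (_* f t₀) (insertAt-lookup ν t₀ a))
               (sum-cong-≗ λ t → cong (_* f (punchIn t₀ t)) (insertAt-punchIn ν t₀ a t)))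

  LinearlyDependent : ∀ {N m} → (Fin N → Vector ℚ m) → Set
  LinearlyDependent vs = ∃[ μ ] (∃[ t ] μ t ≢ 0ℚ) × (∀ c → μ · (λ t → vs t c) ≡ 0ℚ)

  zeroColumn-lift : ∀ {N m} (vs : Fin N → Vector ℚ (suc m)) → (∀ t → vs t zero ≡ 0ℚ) →
                    LinearlyDependent (tail ∘ vs) → LinearlyDependent vs
  zeroColumn-lift vs column₀≡0 (μ , μ≢0 , relation) = μ , μ≢0 , λ where
    zero    → ·-zeroʳ μ column₀≡0
    (suc c) → relation c

  -- Pivoting on row k: subtracting multiples of it clears column zero, and a relation ν among the
  -- reduced rows becomes one among the original rows once row k gets the weight -(ν · multiplier).
  module Elimination {N m} (vs : Fin (suc N) → Vector ℚ (suc m)) (k : Fin (suc N))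
                     (pivot≢0 : vs k zero ≢ 0ℚ) where

    private instance
      pivot-nonZero : NonZero (vs k zero)
      pivot-nonZero = ≢-nonZero pivot≢0

    multiplier : Vector ℚ N
    multiplier t = vs (punchIn k t) zero * 1/ vs k zero

    reduced : Fin N → Vector ℚ (suc m)
    reduced t c = vs (punchIn k t) c - multiplier t * vs k c

    reduced-column₀ : ∀ t → reduced t zero ≡ 0ℚ
    reduced-column₀ t = trans (cong (_-_ x) multiplier*pivot≡x) (+-inverseʳ x)
      where
      x = vs (punchIn k t) zero
      multiplier*pivot≡x : multiplier t * vs k zero ≡ x
      multiplier*pivot≡x = begin
        x * 1/ vs k zero * vs k zero   ≡⟨ *-assoc x _ _ ⟩
        x * (1/ vs k zero * vs k zero) ≡⟨ cong (x *_) (*-inverseˡ (vs k zero)) ⟩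
        x * 1ℚ                         ≡⟨ *-identityʳ x ⟩
        x                              ∎

    lift : LinearlyDependent (tail ∘ reduced) → LinearlyDependent vs
    lift (ν , (t₀ , νt₀≢0) , ν·reduced≡0) = μ , (punchIn k t₀ , μ≢0) , relation
      where
      μ : Vector ℚ (suc N)
      μ = insertAt ν k (- (ν · multiplier))

      μ≢0 : μ (punchIn k t₀) ≢ 0ℚ
      μ≢0 = νt₀≢0 ∘ trans (sym (insertAt-punchIn ν k _ t₀))

      μ·vs≡ν·reduced : ∀ c → μ · (λ t → vs t c) ≡ ν · (λ t → reduced t c)
      μ·vs≡ν·reduced c = begin
        μ · (λ t → vs t c)                 ≡⟨ ·-insertAt ν k _ (λ t → vs t c) ⟩
        - (ν · multiplier) * pivot + ν · f ≡⟨ cong (_+ ν · f) (neg-distribˡ-* (ν · multiplier) pivot) ⟨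
        - (ν · multiplier * pivot) + ν · f ≡⟨ +-comm (- (ν · multiplier * pivot)) (ν · f) ⟩
        ν · f - ν · multiplier * pivot     ≡⟨ cong (_-_ (ν · f)) (·-*ʳ ν multiplier pivot) ⟨
        ν · f - ν · (λ t → multiplier t * pivot) ≡⟨ ·-distrib-- ν f (λ t → multiplier t * pivot) ⟨
        ν · (λ t → reduced t c)            ∎
        where
        pivot = vs k c
        f = λ t → vs (punchIn k t) c

      relation : ∀ c → μ · (λ t → vs t c) ≡ 0ℚ
      relation zero    = trans (μ·vs≡ν·reduced zero) (·-zeroʳ ν reduced-column₀)
      relation (suc c) = trans (μ·vs≡ν·reduced (suc c)) (ν·reduced≡0 c)

  m<N⇒linearlyDependent : ∀ {m N} → m ℕ.< N → (vs : Fin N → Vector ℚ m) → LinearlyDependent vs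
  m<N⇒linearlyDependent {zero}  {suc N} _ vs = (λ _ → 1ℚ) , (zero , λ ()) , λ ()
  m<N⇒linearlyDependent {suc m} {suc N} (ℕ.s≤s m<N) vs with all? (λ t → vs t zero ≟ 0ℚ)
  ... | yes column₀≡0 = zeroColumn-lift vs column₀≡0 (m<N⇒linearlyDependent (m<n⇒m<1+n m<N) (tail ∘ vs))
  ... | no  column₀≢0 with ¬∀⟶∃¬ _ _ (λ t → vs t zero ≟ 0ℚ) column₀≢0
  ...   | k , pivot≢0 = lift (m<N⇒linearlyDependent m<N (tail ∘ reduced))
    where open Elimination vs k pivot≢0

open LinearAlgebra

module AffineHull where

  open import Data.Fin using (_≤_)
  open import Data.Fin.Properties using (all?; ≤-total)
  open import Data.Nat.Properties using (n<1+n)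
  open import Data.Rational using (ℚ; 0ℚ; 1ℚ; _+_; _*_; _-_)
  open import Data.Rational.Properties using (+-*-ring; _≟_; *-comm; *-identityˡ; +-identityʳ; nonNegative⁻¹)
  open import Algebra.Bundles using (Ring)
  open import Algebra.Properties.Semiring.Sum (Ring.semiring +-*-ring) using (sum)
  open import Relation.Nullary.Decidable using (from-yes)
  open ≡-Reasoning

  -- Entry (p, q) of the block (X_ijpq)_pq from s = 1, u = X_ii11, v = X_jj11 and w = X_ij11, by
  -- inclusion–exclusion (zero : Fin 2 is the paper's value 1).  Carrying the constant as s makes
  -- blockEntry p q linear, so that it commutes with weighted sums.
  blockEntry : Fin 2 → Fin 2 → ℚ → ℚ → ℚ → ℚ → ℚ
  blockEntry zero       zero       s u v w = w
  blockEntry zero       (suc zero) s u v w = u - w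
  blockEntry (suc zero) zero       s u v w = v - w
  blockEntry (suc zero) (suc zero) s u v w = s - u - v + w

  blockEntry-zero : ∀ p q → blockEntry p q 0ℚ 0ℚ 0ℚ 0ℚ ≡ 0ℚ
  blockEntry-zero zero       zero       = refl
  blockEntry-zero zero       (suc zero) = refl
  blockEntry-zero (suc zero) zero       = refl
  blockEntry-zero (suc zero) (suc zero) = refl

  ·-blockEntry : ∀ {k} p q (μ s u v w : Vector ℚ k) →
                 μ · (λ t → blockEntry p q (s t) (u t) (v t) (w t))
                   ≡ blockEntry p q (μ · s) (μ · u) (μ · v) (μ · w)
  ·-blockEntry zero       zero       μ s u v w = refl
  ·-blockEntry zero       (suc zero) μ s u v w = ·-distrib-- μ u w
  ·-blockEntry (suc zero) zero       μ s u v w = ·-distrib-- μ v w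
  ·-blockEntry (suc zero) (suc zero) μ s u v w = begin
    μ · (λ t → s t - u t - v t + w t)     ≡⟨ ·-distrib-+ μ (λ t → s t - u t - v t) w ⟩
    μ · (λ t → s t - u t - v t) + μ · w   ≡⟨ cong (_+ μ · w) (·-distrib-- μ (λ t → s t - u t) v) ⟩
    μ · (λ t → s t - u t) - μ · v + μ · w ≡⟨ cong (λ y → y - μ · v + μ · w) (·-distrib-- μ s u) ⟩
    μ · s - μ · u - μ · v + μ · w         ∎

  δ-blockEntry : ∀ p q a b → δ p a * δ q b
                   ≡ blockEntry p q 1ℚ (δ zero a * δ zero a) (δ zero b * δ zero b) (δ zero a * δ zero b)
  δ-blockEntry = from-yes (all? λ p → all? λ q → all? λ a → all? λ b →
    δ p a * δ q b ≟ blockEntry p q 1ℚ (δ zero a * δ zero a) (δ zero b * δ zero b) (δ zero a * δ zero b))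

  BlockDetermined : ∀ {n} → Point n → Set
  BlockDetermined x =
    ∀ i j p q → x i j p q ≡ blockEntry p q 1ℚ (x i i zero zero) (x j j zero zero) (x i j zero zero)

  X-blockDetermined : ∀ {n} (ρ : Fin n → Fin 2) → BlockDetermined (X ρ)
  X-blockDetermined ρ i j p q = δ-blockEntry p q (ρ i) (ρ j)

  combination-blockEntry :
    ∀ {n k} {ys : Fin k → Point n} (μ : Vector ℚ k) → (∀ t → BlockDetermined (ys t)) →
    ∀ {i j} p q {s u v w} → sum μ ≡ s → μ · (λ t → ys t i i zero zero) ≡ u →
    μ · (λ t → ys t j j zero zero) ≡ v → μ · (λ t → ys t i j zero zero) ≡ w →
    μ · (λ t → ys t i j p q) ≡ blockEntry p q s u v w
  combination-blockEntry {ys = ys} μ ys-determined {i} {j} p q refl refl refl refl = begin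
    μ · (λ t → ys t i j p q)                                ≡⟨ ·-cong μ (λ t → ys-determined t i j p q) ⟩
    μ · (λ t → blockEntry p q 1ℚ (yᵢᵢ t) (yⱼⱼ t) (yᵢⱼ t))  ≡⟨ ·-blockEntry p q μ (λ _ → 1ℚ) yᵢᵢ yⱼⱼ yᵢⱼ ⟩
    blockEntry p q (μ · (λ _ → 1ℚ)) (μ · yᵢᵢ) (μ · yⱼⱼ) (μ · yᵢⱼ)
      ≡⟨ cong (λ s → blockEntry p q s (μ · yᵢᵢ) (μ · yⱼⱼ) (μ · yᵢⱼ)) (·-identityʳ μ) ⟩
    blockEntry p q (sum μ) (μ · yᵢᵢ) (μ · yⱼⱼ) (μ · yᵢⱼ)    ∎
    where
    yᵢᵢ yⱼⱼ yᵢⱼ : Vector ℚ _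
    yᵢᵢ t = ys t i i zero zero
    yⱼⱼ t = ys t j j zero zero
    yᵢⱼ t = ys t i j zero zero

  X-∈Ω : ∀ {n} (ρ : Fin n → Fin 2) → Ω n (X ρ)
  X-∈Ω ρ = 1 , (λ _ → ρ) , (λ _ → 1ℚ) , (λ _ → nonNegative⁻¹ 1ℚ) , refl ,
    λ i j p q → sym (trans (+-identityʳ _) (*-identityˡ _))

  Ω⇒combination : ∀ {n} {x : Point n} → Ω n x →
    ∃[ k ] ∃[ ρs ] ∃[ μ ] sum {k} μ ≡ 1ℚ × (∀ i j p q → x i j p q ≡ μ · (λ t → X (ρs t) i j p q))
  Ω⇒combination (k , ρs , μ , _ , Σμ≡1 , x≡) = k , ρs , μ , trans (sym (sumFin≡sum k μ)) Σμ≡1 ,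
    λ i j p q → trans (x≡ i j p q) (sumFin≡sum k (λ t → μ t * X (ρs t) i j p q))

  Ω-blockDetermined : ∀ {n} {x : Point n} → Ω n x → BlockDetermined x
  Ω-blockDetermined x∈Ω i j p q with Ω⇒combination x∈Ω
  ... | _ , ρs , μ , Σμ≡1 , x≡ = trans (x≡ i j p q)
    (combination-blockEntry μ (X-blockDetermined ∘ ρs) p q Σμ≡1
      (sym (x≡ i i zero zero)) (sym (x≡ j j zero zero)) (sym (x≡ i j zero zero)))

  Ω-symmetric : ∀ {n} {x : Point n} → Ω n x → ∀ i j → x i j zero zero ≡ x j i zero zero
  Ω-symmetric {x = x} x∈Ω i j with Ω⇒combination x∈Ω
  ... | _ , ρs , μ , _ , x≡ = begin
    x i j zero zero                    ≡⟨ x≡ i j zero zero ⟩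
    μ · (λ t → X (ρs t) i j zero zero) ≡⟨ ·-cong μ (λ t → *-comm (δ zero (ρs t i)) (δ zero (ρs t j))) ⟩
    μ · (λ t → X (ρs t) j i zero zero) ≡⟨ x≡ j i zero zero ⟨
    x j i zero zero                    ∎

  chart : ∀ {n N} → (Fin N → Point n) → Fin N → Vector ℚ (suc (triangle n))
  chart {n} ps t = 1ℚ ∷ λ s → ps t (proj₁ (pair n s)) (proj₂ (pair n s)) zero zero

  Ω-notAffinelyIndependent : ∀ n (ps : Fin (2 ℕ.+ triangle n) → Point n) → (∀ t → Ω n (ps t)) →
                             ¬ AffinelyIndependent ps
  Ω-notAffinelyIndependent n ps ps∈Ω independent
    with m<N⇒linearlyDependent (n<1+n _) (chart ps)
  ... | μ , (t₀ , μt₀≢0) , μ·chart≡0 = μt₀≢0 (independent μ (trans (sumFin≡sum _ μ) Σμ≡0) relation t₀)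
    where
    Σμ≡0 : sum μ ≡ 0ℚ
    Σμ≡0 = trans (sym (·-identityʳ μ)) (μ·chart≡0 zero)

    ordered₀₀ : ∀ {i j} → i ≤ j → μ · (λ t → ps t i j zero zero) ≡ 0ℚ
    ordered₀₀ i≤j with pair-surjective i≤j
    ... | s , pair-s≡ij =
      subst (λ e → μ · (λ t → ps t (proj₁ e) (proj₂ e) zero zero) ≡ 0ℚ) pair-s≡ij (μ·chart≡0 (suc s))

    relation₀₀ : ∀ i j → μ · (λ t → ps t i j zero zero) ≡ 0ℚ
    relation₀₀ i j with ≤-total i j
    ... | inj₁ i≤j = ordered₀₀ i≤j
    ... | inj₂ j≤i = trans (·-cong μ λ t → Ω-symmetric (ps∈Ω t) i j) (ordered₀₀ j≤i)

    relation : ∀ i j p q → sumFin _ (λ t → μ t * ps t i j p q) ≡ 0ℚ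
    relation i j p q = begin
      sumFin _ (λ t → μ t * ps t i j p q) ≡⟨ sumFin≡sum _ (λ t → μ t * ps t i j p q) ⟩
      μ · (λ t → ps t i j p q)            ≡⟨ combination-blockEntry μ (Ω-blockDetermined ∘ ps∈Ω) p q Σμ≡0
                                               (relation₀₀ i i) (relation₀₀ j j) (relation₀₀ i j) ⟩
      blockEntry p q 0ℚ 0ℚ 0ℚ 0ℚ          ≡⟨ blockEntry-zero p q ⟩
      0ℚ                                  ∎

open AffineHull

module AffineBasis where

  open import Data.Fin using (_≤_; _<_; _≟_)
  open import Data.Fin.Properties using (<-irrefl; toℕ-injective)
  open import Data.Nat.Properties using (<⇒≱; m≤n⇒m<n∨m≡n)
  open import Data.Bool using (if_then_else_)
  open import Data.Sum using ([_,_]′; map₂)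
  open import Data.Rational using (ℚ; 0ℚ; 1ℚ; _+_; _*_)
  open import Data.Rational.Properties using (+-*-ring; *-identityʳ; *-zeroˡ; *-zeroʳ; +-identityʳ)
  open import Algebra.Bundles using (Ring)
  open import Algebra.Properties.Semiring.Sum (Ring.semiring +-*-ring) using (sum)
  open import Relation.Nullary using (Dec; does)
  open import Relation.Nullary.Decidable using (dec-true; dec-false; _⊎-dec_)
  open ≡-Reasoning

  _∈ₚ_ : ∀ {n} → Fin n → Fin n × Fin n → Set
  k ∈ₚ e = k ≡ proj₁ e ⊎ k ≡ proj₂ e

  _∈ₚ?_ : ∀ {n} (k : Fin n) e → Dec (k ∈ₚ e)
  k ∈ₚ? e = (k ≟ proj₁ e) ⊎-dec (k ≟ proj₂ e)

  indicator : ∀ {n} → Fin n × Fin n → Fin n → Fin 2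
  indicator e k = if does (k ∈ₚ? e) then zero else suc zero

  δ₀-indicator-∈ : ∀ {n} {e : Fin n × Fin n} {k} → k ∈ₚ e → δ zero (indicator e k) ≡ 1ℚ
  δ₀-indicator-∈ {e = e} {k} k∈e =
    cong (λ b → δ zero (if b then zero else suc zero)) (dec-true (k ∈ₚ? e) k∈e)

  δ₀-indicator-∉ : ∀ {n} {e : Fin n × Fin n} {k} → ¬ k ∈ₚ e → δ zero (indicator e k) ≡ 0ℚ
  δ₀-indicator-∉ {e = e} {k} k∉e =
    cong (λ b → δ zero (if b then zero else suc zero)) (dec-false (k ∈ₚ? e) k∉e)

  X-indicator-∈ : ∀ {n} {e : Fin n × Fin n} {i j} → i ∈ₚ e → j ∈ₚ e →
                  X (indicator e) i j zero zero ≡ 1ℚ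
  X-indicator-∈ i∈e j∈e = cong₂ _*_ (δ₀-indicator-∈ i∈e) (δ₀-indicator-∈ j∈e)

  X-indicator-∉ : ∀ {n} {e : Fin n × Fin n} {i j} → ¬ (i ∈ₚ e × j ∈ₚ e) →
                  X (indicator e) i j zero zero ≡ 0ℚ
  X-indicator-∉ {e = e} {i} {j} ¬both with i ∈ₚ? e
  ... | yes i∈e = trans (cong (δ zero (indicator e i) *_) (δ₀-indicator-∉ λ j∈e → ¬both (i∈e , j∈e)))
                        (*-zeroʳ (δ zero (indicator e i)))
  ... | no  i∉e = trans (cong (_* δ zero (indicator e j)) (δ₀-indicator-∉ i∉e))
                        (*-zeroˡ (δ zero (indicator e j)))

  ordered-covers : ∀ {n} {a b i j : Fin n} → a ≤ b → i < j → i ∈ₚ (a , b) → j ∈ₚ (a , b) →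
                   (a , b) ≡ (i , j)
  ordered-covers a≤b i<j (inj₁ refl) (inj₁ refl) = contradiction i<j (<-irrefl refl)
  ordered-covers a≤b i<j (inj₁ refl) (inj₂ refl) = refl
  ordered-covers a≤b i<j (inj₂ refl) (inj₁ refl) = contradiction a≤b (<⇒≱ i<j)
  ordered-covers a≤b i<j (inj₂ refl) (inj₂ refl) = contradiction i<j (<-irrefl refl)

  diagonal-covers : ∀ {n} {a b i : Fin n} → a ≡ b → i ∈ₚ (a , b) → (a , b) ≡ (i , i)
  diagonal-covers refl (inj₁ refl) = refl
  diagonal-covers refl (inj₂ refl) = refl

  pair-shape : ∀ n s → proj₁ (pair n s) < proj₂ (pair n s) ⊎ proj₁ (pair n s) ≡ proj₂ (pair n s)
  pair-shape n s = map₂ toℕ-injective (m≤n⇒m<n∨m≡n (pair-ordered n s))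

  basisLabel : ∀ n → Fin (suc (triangle n)) → Fin n → Fin 2
  basisLabel n zero    = λ _ → suc zero
  basisLabel n (suc s) = indicator (pair n s)

  module BasisRelation {n} (μ : Vector ℚ (suc (triangle n)))
                       (relation₀₀ : ∀ i j → μ · (λ t → X (basisLabel n t) i j zero zero) ≡ 0ℚ) where

    isolate : ∀ s {i j} → i ∈ₚ pair n s → j ∈ₚ pair n s →
              (∀ t → t ≢ s → μ (suc t) * X (indicator (pair n t)) i j zero zero ≡ 0ℚ) → μ (suc s) ≡ 0ℚ
    isolate s {i} {j} i∈ j∈ others = begin
      μ (suc s)                                          ≡⟨ *-identityʳ (μ (suc s)) ⟨
      μ (suc s) * 1ℚ                                     ≡⟨ cong (μ (suc s) *_) (X-indicator-∈ i∈ j∈) ⟨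
      μ (suc s) * X (basisLabel n (suc s)) i j zero zero ≡⟨ sum-single _ (suc s) others′ ⟨
      μ · (λ t → X (basisLabel n t) i j zero zero)       ≡⟨ relation₀₀ i j ⟩
      0ℚ                                                 ∎
      where
      others′ : ∀ t → t ≢ suc s → μ t * X (basisLabel n t) i j zero zero ≡ 0ℚ
      others′ zero    _   = *-zeroʳ (μ zero)
      others′ (suc t) t≢s = others t (t≢s ∘ cong suc)

    offDiagonal : ∀ s → proj₁ (pair n s) < proj₂ (pair n s) → μ (suc s) ≡ 0ℚ
    offDiagonal s a<b = isolate s (inj₁ refl) (inj₂ refl) λ t t≢s →
      trans (cong (μ (suc t) *_) (X-indicator-∉ {e = pair n t} λ (a∈ , b∈) →
              t≢s (pair-injective (ordered-covers (pair-ordered n t) a<b a∈ b∈))))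
            (*-zeroʳ (μ (suc t)))

    diagonal : ∀ s → proj₁ (pair n s) ≡ proj₂ (pair n s) → μ (suc s) ≡ 0ℚ
    diagonal s a≡b = isolate s (inj₁ refl) (inj₁ refl) others
      where
      a = proj₁ (pair n s)
      Xₜ : Fin (triangle n) → ℚ
      Xₜ t = X (indicator (pair n t)) a a zero zero
      others : ∀ t → t ≢ s → μ (suc t) * Xₜ t ≡ 0ℚ
      others t t≢s with a ∈ₚ? pair n t | pair-shape n t
      ... | no a∉  | _         = trans (cong (μ (suc t) *_) (X-indicator-∉ {e = pair n t} {a} {a} (a∉ ∘ proj₁)))
                                       (*-zeroʳ (μ (suc t)))
      ... | yes _  | inj₁ a<b  = trans (cong (_* Xₜ t) (offDiagonal t a<b)) (*-zeroˡ (Xₜ t))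
      ... | yes a∈ | inj₂ a≡b′ =
        contradiction (pair-injective (trans (diagonal-covers a≡b′ a∈) (cong (a ,_) a≡b))) t≢s

    μ∘suc≡0 : ∀ s → μ (suc s) ≡ 0ℚ
    μ∘suc≡0 s = [ offDiagonal s , diagonal s ]′ (pair-shape n s)

  basis-independent : ∀ n → AffinelyIndependent (X ∘ basisLabel n)
  basis-independent n μ Σμ≡0 relation = λ where
      zero    → begin
        μ zero      ≡⟨ +-identityʳ (μ zero) ⟨
        μ zero + 0ℚ ≡⟨ cong (μ zero +_) (sum-zero μ∘suc≡0) ⟨
        sum μ       ≡⟨ sumFin≡sum _ μ ⟨
        sumFin _ μ  ≡⟨ Σμ≡0 ⟩
        0ℚ          ∎
      (suc s) → μ∘suc≡0 s
    where
    open BasisRelation μ (λ i j → trans (sym (sumFin≡sum _ (λ t → μ t * X (basisLabel n t) i j zero zero)))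
                                        (relation i j zero zero))

open AffineBasis

open import Data.Nat using (_*_; _≤_)
open import Data.Nat.DivMod using (_/_)

theorem2 : (n : ℕ) → 2 ≤ n → HasDimension (Ω n) ((n * suc n) / 2)
theorem2 n _ = subst (HasDimension (Ω n)) (triangle≡n*[1+n]/2 n)
  ((X ∘ basisLabel n , X-∈Ω ∘ basisLabel n , basis-independent n) , Ω-notAffinelyIndependent n)
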